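{- If $U$ is a $\lambda X$-term satisfying property $(P)$, then there is a $\lambda x$-term $U'$ such that $\triangle(U')=U$.
   Context: Application of $t$ to $u$ is written $(t)u$, and $(t)u_1\dots u_n$ means $(\dots((t)u_1)\dots)u_n$; $\overline{c}$ denotes a finite (possibly empty) sequence of terms. $\lambda X$-terms: let $\{X_i\}_{i\ge 0}$ be distinct constants. Every variable and every $X_i$ is a $\lambda X$-term; if $x$ is a variable and $u$ a $\lambda X$-term then $\lambda x u$ is one; if $u,v$ are $\lambda X$-terms then $(u)v$ is one; if $n\in\mathbb{N}$ and $a,b,\overline{c}$ are $\lambda X$-terms, then $X_{n,a,b,\overline{c}}$ is a $\lambda X$-term, regarded as a new constant (an atom not occurring in $a,b,\overline{c}$). $\lambda x$-terms are defined identically using distinct constants $\{x_i\}_{i\ge0}$ and $x_{n,a,b,\overline{c}}$ (for $n\in\mathbb{N}$ and $\lambda x$-terms $a,b,\overline{c}$). Terms are taken modulo $\alpha$-equivalence. The map $\triangle$ from $\lambda x$-terms to $\lambda X$-terms is defined by: $\triangle(x_n)=X_n$; $\triangle(x_{k,a,b,\overline{c}})=(X_{k,\triangle(a),\triangle(b),\overline{\triangle(c)}})\triangle(a)\triangle(b)$; $\triangle(y)=y$ for variables $y$; and $\triangle$ commutes with abstraction and application. Property $(P)$: a $\lambda X$-term $U$ satisfies $(P)$ iff for each constant $X_{l,a,b,\overline{c}}$ occurring in $U$: $a,b$ and each term of $\overline{c}$ satisfy $(P)$; every occurrence of $X_{l,a,b,\overline{c}}$ in $U$ is applied to $a$ and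 $b$ (i.e. occurs as the head of a subterm $(X_{l,a,b,\overline{c}})ab\dots$); and $a,b$ contain no free variables that are bound in $U$. -}

module Defs where

open import Data.Nat using (ℕ)
open import Data.List using (List; []; _∷_)
open import Data.List.Relation.Unary.All using (All)
open import Data.Product using (_×_)
open import Data.Unit using (⊤)
open import Data.Empty using (⊥)
open import Relation.Nullary using (¬_)
open import Relation.Binary.PropositionalEquality using (_≡_)

Var : Set
Var = ℕ

-- λX-terms.  X i is the constant X_i; Xc n a b cs is the constant
-- X_{n,a,b,cs}, an atom whose "name" carries the terms a, b, cs.
data ΛX : Set where
  var : Var → ΛX
  X   : ℕ → ΛX
  lam : Var → ΛX → ΛX
  app : ΛX → ΛX → ΛX
  Xc  : ℕ → ΛX → ΛX → List ΛX → ΛX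

data Λx : Set where
  var : Var → Λx
  x   : ℕ → Λx
  lam : Var → Λx → Λx
  app : Λx → Λx → Λx
  xc  : ℕ → Λx → Λx → List Λx → Λx

mutual
  △ : Λx → ΛX
  △ (var y)        = var y
  △ (x n)          = X n
  △ (lam y u)      = lam y (△ u)
  △ (app u v)      = app (△ u) (△ v)
  △ (xc k a b cs)  = app (app (Xc k (△ a) (△ b) (△* cs)) (△ a)) (△ b)

  △* : List Λx → List ΛX
  △* []       = []
  △* (c ∷ cs) = △ c ∷ △* cs

-- Occurrences of the constant X_{n,a,b,cs} in U.  Constants are atoms:
-- we do not look inside the indices of other constants.
data Occ (n : ℕ) (a b : ΛX) (cs : List ΛX) : ΛX → Set where
  here : Occ n a b cs (Xc n a b cs)
  lam  : ∀ {y u} → Occ n a b cs u → Occ n a b cs (lam y u)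
  appl : ∀ {u v} → Occ n a b cs u → Occ n a b cs (app u v)
  appr : ∀ {u v} → Occ n a b cs v → Occ n a b cs (app u v)

-- y is a free variable of t (constants are atoms, so their indices
-- contribute no free variables).
data FV (y : Var) : ΛX → Set where
  var  : FV y (var y)
  lam  : ∀ {z u} → ¬ (z ≡ y) → FV y u → FV y (lam z u)
  appl : ∀ {u v} → FV y u → FV y (app u v)
  appr : ∀ {u v} → FV y v → FV y (app u v)

data BV (y : Var) : ΛX → Set where
  here : ∀ {u} → BV y (lam y u)
  lam  : ∀ {z u} → BV y u → BV y (lam z u)
  appl : ∀ {u v} → BV y u → BV y (app u v)
  appr : ∀ {u v} → BV y v → BV y (app u v)

-- Every occurrence of a constant X_{n,a,b,cs} in U is the head of a
-- subterm (X_{n,a,b,cs}) a b ... .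
Applied : ΛX → Set
Applied (var y)   = ⊤
Applied (X n)     = ⊤
Applied (lam y u) = Applied u
Applied (Xc n a b cs) = ⊥
Applied (app (app (Xc n a b cs) a′) b′) = (a′ ≡ a) × (b′ ≡ b) × Applied a′ × Applied b′
Applied (app u v) = Applied u × Applied v

NoCapture : ΛX → ΛX → Set
NoCapture t U = ∀ y → FV y t → ¬ BV y U

data P : ΛX → Set where
  mkP : ∀ {U} →
        (∀ {n a b cs} → Occ n a b cs U →
            P a × P b × All P cs × NoCapture a U × NoCapture b U) →
        Applied U →
        P U

-- Read U bottom-up: every redex (X_{n,a,b,cs}) a b comes from x_{n,a′,b′,cs′}, where
-- a′, b′, cs′ are preimages of the indices (they satisfy (P), so recursion applies),
-- and everything else is translated homomorphically.  Because (P) forbids bare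
-- occurrences of the constants, no other shape can arise.
module Submission where

open import Defs
open import Data.Product using (Σ; _,_; _×_)
open import Data.List using (List; []; _∷_)
open import Data.List.Relation.Unary.All using (All; []; _∷_)
open import Relation.Binary.PropositionalEquality using (_≡_; refl)

Preimage : ΛX → Set
Preimage U = Σ Λx (λ U′ → △ U′ ≡ U)

Preimage* : List ΛX → Set
Preimage* cs = Σ (List Λx) (λ cs′ → △* cs′ ≡ cs)

IndicesSatisfyP : ΛX → Set
IndicesSatisfyP U = ∀ {n a b cs} → Occ n a b cs U → P a × P b × All P cs

data AppliedApp : ΛX → ΛX → Set where
  constant : ∀ n a b cs → AppliedApp (app (Xc n a b cs) a) b
  ordinary : ∀ {u v} → Applied u → Applied v → AppliedApp u v

-- Applied (app u v) reduces only once the head of u is known, hence the exhaustive split.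
appliedApp : ∀ u v → Applied (app u v) → AppliedApp u v
appliedApp (app (Xc n a b cs) .a) .b (refl , refl , _) = constant n a b cs
appliedApp (var y)               v (au , av) = ordinary au av
appliedApp (X m)                 v (au , av) = ordinary au av
appliedApp (lam y w)             v (au , av) = ordinary au av
appliedApp (Xc m a b cs)         v (au , av) = ordinary au av
appliedApp (app (var y) w)       v (au , av) = ordinary au av
appliedApp (app (X m) w)         v (au , av) = ordinary au av
appliedApp (app (lam y w₁) w)    v (au , av) = ordinary au av
appliedApp (app (app w₁ w₂) w)   v (au , av) = ordinary au av

mutual
  preimage : ∀ U → IndicesSatisfyP U → Applied U → Preimage U
  preimage (var y)   _ _ = var y , refl
  preimage (X n)     _ _ = x n , refl
  preimage (lam y u) H A with preimage u (λ o → H (lam o)) A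
  ... | u′ , refl = lam y u′ , refl
  preimage (Xc n a b cs) _ ()
  preimage (app u v) H A = preimage-app u v H (appliedApp u v A)

  preimage-app : ∀ u v → IndicesSatisfyP (app u v) → AppliedApp u v → Preimage (app u v)
  preimage-app _ _ H (constant n a b cs) with H (appl (appl here))
  ... | Pa , Pb , Pcs with preimage-P a Pa | preimage-P b Pb | preimage-All cs Pcs
  ...   | a′ , refl | b′ , refl | cs′ , refl = xc n a′ b′ cs′ , refl
  preimage-app u v H (ordinary Au Av)
    with preimage u (λ o → H (appl o)) Au | preimage v (λ o → H (appr o)) Av
  ... | u′ , refl | v′ , refl = app u′ v′ , refl

  preimage-P : ∀ U → P U → Preimage U
  preimage-P U (mkP occ A) = preimage U indices A
    where
    indices : IndicesSatisfyP U
    indices o with occ o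
    ... | Pa , Pb , Pcs , _ = Pa , Pb , Pcs

  preimage-All : ∀ cs → All P cs → Preimage* cs
  preimage-All []       []         = [] , refl
  preimage-All (c ∷ cs) (Pc ∷ Pcs) with preimage-P c Pc | preimage-All cs Pcs
  ... | c′ , refl | cs′ , refl = c′ ∷ cs′ , refl

lemma2 : (U : ΛX) → P U → Σ Λx (λ U′ → △ U′ ≡ U)
lemma2 = preimage-P
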